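{- There is a constant $C > 0$ such that for every $n \ge 4$, the complete graph $K_n$ satisfies $\mathrm{str}_{\mathrm{gap}}(K_n) \le C\, n^{3/2}$; that is, $\mathrm{str}_{\mathrm{gap}}(K_n) \in O(n^{3/2})$.
   Context: For $k \in \mathbb{N}$ and $[k] = \{1, \ldots, k\}$, a gap-$[k]$-vertex-labelling of a connected graph $G$ is a pair $(\pi, c_\pi)$ where $\pi : V(G) \to [k]$ and $c_\pi : V(G) \to \{0, 1, \ldots, k\}$ is a proper vertex colouring of $G$ such that for every $v \in V(G)$: if $d(v) \ge 2$ then $c_\pi(v) = \max_{u \in N(v)} \pi(u) - \min_{u \in N(v)} \pi(u)$, and if $d(v) = 1$ then $c_\pi(v) = \pi(u)$ where $u$ is the unique neighbour of $v$. A connected graph is gap-vertex-labelable if it admits a gap-$[k]$-vertex-labelling for some $k$; a graph is gap-vertex-labelable iff all its connected components are. For a graph $G$ and $l \ge 0$, $G^{ -l}$ is the family of graphs obtained from $G$ by removing $l$ edges. For a graph $G$ that is not gap-vertex-labelable (e.g. $K_n$ with $n \ge 4$), its gap-strength $\mathrm{str}_{\mathrm{gap}}(G)$ is the least $l$ such that some graph in $G^{ -l}$ is gap-vertex-labelable. -}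

module Defs where

open import Data.Nat using (ℕ; zero; suc; _+_; _*_; _∸_; _^_; _≤_; _<_; _≥_; _⊔_; _⊓_)
open import Data.Fin using (Fin; toℕ)
open import Data.Fin.Properties using () renaming (_≟_ to _≟ᶠ_)
open import Data.Bool using (Bool; true; false; not; _∧_; _∨_)
open import Data.List using (List; []; _∷_; length; filterᵇ; allFin; map; foldr)
open import Data.Bool.ListAction using (any)
open import Data.List.Relation.Unary.All using (All)
open import Data.List.Relation.Unary.Unique.Propositional using (Unique)
open import Data.Product using (Σ; _×_; _,_; ∃; ∃-syntax)
open import Relation.Nullary.Decidable using (⌊_⌋)
open import Relation.Binary.PropositionalEquality using (_≡_; _≢_)

-- A set of edges of K_n (vertex set Fin n) to be removed, given as a
-- duplicate-free list of pairs (i , j) with i < j (each unordered edge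
-- represented exactly once).
EdgeList : ℕ → Set
EdgeList n = List (Fin n × Fin n)

WellFormedRemoval : ∀ {n} → EdgeList n → Set
WellFormedRemoval R = All (λ e → toℕ (Data.Product.proj₁ e) < toℕ (Data.Product.proj₂ e)) R × Unique R

memb : ∀ {n} → Fin n → Fin n → EdgeList n → Bool
memb i j R = any (λ e → ⌊ Data.Product.proj₁ e ≟ᶠ i ⌋ ∧ ⌊ Data.Product.proj₂ e ≟ᶠ j ⌋) R

Adj : ∀ {n} → EdgeList n → Fin n → Fin n → Bool
Adj R u v = not ⌊ u ≟ᶠ v ⌋ ∧ not (memb u v R ∨ memb v u R)

nbrs : ∀ {n} → EdgeList n → Fin n → List (Fin n)
nbrs {n} R v = filterᵇ (λ u → Adj R u v) (allFin n)

deg : ∀ {n} → EdgeList n → Fin n → ℕ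
deg R v = length (nbrs R v)

-- maximum / minimum of a list of naturals (only used on non-empty lists)
maxL : List ℕ → ℕ
maxL = foldr _⊔_ 0

minL : List ℕ → ℕ
minL []       = 0
minL (x ∷ xs) = foldr _⊓_ x xs

record IsGapLabelling {n} (R : EdgeList n) (k : ℕ) (π c : Fin n → ℕ) : Set where
  field
    π-range   : ∀ v → 1 ≤ π v × π v ≤ k
    c-range   : ∀ v → c v ≤ k
    proper    : ∀ u v → Adj R u v ≡ true → c u ≢ c v
    gap-rule  : ∀ v → 2 ≤ deg R v →
                c v ≡ maxL (map π (nbrs R v)) ∸ minL (map π (nbrs R v))
    leaf-rule : ∀ v u → deg R v ≡ 1 → Adj R u v ≡ true → c v ≡ π u

GapVertexLabelable : ∀ {n} → EdgeList n → Set
GapVertexLabelable {n} R = ∃[ k ] ∃[ π ] ∃[ c ] IsGapLabelling {n} R k π c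

SomeInKnMinusLabelable : ℕ → ℕ → Set
SomeInKnMinusLabelable n l =
  Σ (EdgeList n) λ R → WellFormedRemoval R × length R ≡ l × GapVertexLabelable R

-- Let s = ⌊√n⌋ + 1, so that n ≤ s² ≤ 4n. Call the last s vertices top vertices, the t-th of them
-- labelled 2t + 1, and cut the other vertices into consecutive blocks of size s, all labelled 1.
-- Delete the edges inside the top, inside each block, and between block g and top vertex t whenever
-- t > g + 1. As n ≤ s², the top vertices 0 and g + 1 exist, so a vertex of block g sees both labels
-- 1 and 2g + 3 and nothing outside that range: its colour is 2g + 2. A top vertex sees only the
-- label 1, so its colour is 0 or 1; adjacent bottom vertices lie in different blocks, so the colouring
-- is proper. A vertex loses at most 2s edges towards later vertices (the rest of its block and the
-- top), so l ≤ 2sn and l² ≤ 16n³.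

module Submission where

open import Defs
open import Data.Nat using (ℕ; _*_; _^_; _≤_; _<_; _≥_)
open import Data.Product using (Σ; _×_; ∃-syntax)

open import Data.Nat using (NonZero; zero; suc; _+_; _∸_; z≤n; s≤s; z<s; s<s; _≤?_; _<?_)
open import Data.Nat.Properties
open import Data.Nat.DivMod using (_/_; _%_; m≡m%n+[m/n]*n; m%n<n; m/n*n≤m; m<n*o⇒m/o<n)
open import Data.Nat.Solver using (module +-*-Solver)
open import Data.Fin using (Fin; toℕ; fromℕ<)
import Data.Fin as F
open import Data.Fin.Properties using (toℕ-fromℕ<; toℕ<n)
  renaming (_≟_ to _≟ᶠ_; _<?_ to _<ᶠ?_; <-cmp to <ᶠ-cmp)
open import Data.Bool using (Bool; true; false; not; _∧_; _∨_; T; T?)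
open import Data.Bool.Properties using (T-≡; T-∧; T-∨)
open import Data.List using (List; []; _∷_; _++_; length; filter; map; allFin; cartesianProduct)
open import Data.List.Properties
  using (foldr-preservesᵇ; foldr-preservesᵒ; length-map; length-++; length-tabulate; map-tabulate; filter-++)
open import Data.List.Membership.Propositional using (_∈_; find; lose)
open import Data.List.Membership.Propositional.Properties
  using (∈-map⁺; ∈-filter⁺; ∈-filter⁻; ∈-allFin; ∈-cartesianProduct⁺)
open import Data.List.Relation.Unary.All using (All; []; _∷_)
import Data.List.Relation.Unary.All as All
import Data.List.Relation.Unary.All.Properties as All
open import Data.List.Relation.Unary.AllPairs using (AllPairs; []; _∷_)
import Data.List.Relation.Unary.AllPairs as AllPairs
import Data.List.Relation.Unary.AllPairs.Properties as AllPairs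
open import Data.List.Relation.Unary.Any using (here)
import Data.List.Relation.Unary.Any as Any
open import Data.List.Relation.Unary.Any.Properties using (any⁺; any⁻)
open import Data.List.Relation.Unary.Unique.Propositional.Properties
  using (filter⁺; cartesianProduct⁺; allFin⁺)
open import Data.Product using (_,_; proj₁; proj₂)
open import Data.Sum using (_⊎_; inj₁; inj₂; [_,_])
open import Data.Unit using (⊤; tt)
open import Function using (id; _∘_)
open import Function.Bundles using (Equivalence)
open import Level using (0ℓ)
open import Relation.Nullary using (¬_; Dec; yes; no; contradiction)
open import Relation.Nullary.Decidable
  using (⌊_⌋; _×-dec_; toWitness; toWitnessFalse; fromWitness; fromWitnessFalse)
open import Relation.Unary using (Pred; Decidable)
open import Relation.Binary.Definitions using (tri<; tri≈; tri>)
open import Relation.Binary.PropositionalEquality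
  using (_≡_; _≢_; refl; sym; trans; cong; cong₂; subst; subst₂; module ≡-Reasoning)

maxL-upper : ∀ {x xs} → x ∈ xs → x ≤ maxL xs
maxL-upper {x} {xs} x∈xs = foldr-preservesᵒ {P = x ≤_}
  (λ a b → [ m≤n⇒m≤n⊔o b , m≤n⇒m≤o⊔n a ]) 0 xs (inj₂ (Any.map ≤-reflexive x∈xs))

maxL-least : ∀ {m xs} → All (_≤ m) xs → maxL xs ≤ m
maxL-least = foldr-preservesᵇ ⊔-lub z≤n

minL-lower : ∀ {x xs} → x ∈ xs → minL xs ≤ x
minL-lower {x} {y ∷ ys} x∈xs = foldr-preservesᵒ {P = _≤ x}
  (λ a b → [ m≤n⇒m⊓o≤n b , m≤n⇒o⊓m≤n a ]) y ys
  (Any.toSum (Any.map (≤-reflexive ∘ sym) x∈xs))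

minL-greatest : ∀ {m y ys} → All (m ≤_) (y ∷ ys) → m ≤ minL (y ∷ ys)
minL-greatest (m≤y ∷ m≤ys) = foldr-preservesᵇ ⊓-glb m≤y m≤ys

module _ {A : Set} (f : A → ℕ) where

  spread : List A → ℕ
  spread []               = 0
  spread (u ∷ [])         = f u
  spread us@(_ ∷ _ ∷ _)   = maxL (map f us) ∸ minL (map f us)

  spread-≤ : ∀ {b us} → All (λ u → f u ≤ b) us → spread us ≤ b
  spread-≤ []                = z≤n
  spread-≤ (fu≤b ∷ [])       = fu≤b
  spread-≤ {us = us} us≤b@(_ ∷ _ ∷ _) =
    ≤-trans (m∸n≤m (maxL (map f us)) (minL (map f us))) (maxL-least (All.map⁺ us≤b))

  spread-≡ : ∀ {lo hi a b us} → lo ∈ us → hi ∈ us → lo ≢ hi → f lo ≡ a → f hi ≡ b →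
             All (λ u → a ≤ f u × f u ≤ b) us → spread us ≡ b ∸ a
  spread-≡ {us = _ ∷ []} (here refl) (here refl) lo≢hi _ _ _ = contradiction refl lo≢hi
  spread-≡ {us = _ ∷ _ ∷ _} lo∈us hi∈us _ refl refl bounds = cong₂ _∸_
    (≤-antisym (maxL-least (All.map⁺ (All.map proj₂ bounds))) (maxL-upper (∈-map⁺ f hi∈us)))
    (≤-antisym (minL-lower (∈-map⁺ f lo∈us)) (minL-greatest (All.map⁺ (All.map proj₁ bounds))))

  spread-gap : ∀ {us} → 2 ≤ length us → spread us ≡ maxL (map f us) ∸ minL (map f us)
  spread-gap {_ ∷ []} (s≤s ())
  spread-gap {_ ∷ _ ∷ _} _ = refl

  spread-leaf : ∀ {u us} → length us ≡ 1 → u ∈ us → spread us ≡ f u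
  spread-leaf {us = _ ∷ []} _ (here refl) = refl

module _ {n} (R : EdgeList n) where

  ∈-nbrs⁺ : ∀ {u v} → Adj R u v ≡ true → u ∈ nbrs R v
  ∈-nbrs⁺ {u} {v} adj = ∈-filter⁺ (λ w → T? (Adj R w v)) (∈-allFin u) (Equivalence.from T-≡ adj)

  ∈-nbrs⁻ : ∀ {u v} → u ∈ nbrs R v → Adj R u v ≡ true
  ∈-nbrs⁻ {v = v} u∈ =
    Equivalence.to T-≡ (proj₂ (∈-filter⁻ (λ w → T? (Adj R w v)) {xs = allFin n} u∈))

  gapColour : (Fin n → ℕ) → Fin n → ℕ
  gapColour π v = spread π (nbrs R v)

  gapColour-isGapLabelling : ∀ {k} (π : Fin n → ℕ) → (∀ v → 1 ≤ π v × π v ≤ k) →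
    (∀ u v → Adj R u v ≡ true → gapColour π u ≢ gapColour π v) →
    IsGapLabelling R k π (gapColour π)
  gapColour-isGapLabelling π π-range proper = record
    { π-range   = π-range
    ; c-range   = λ v → spread-≤ π {us = nbrs R v} (All.tabulate (λ {u} _ → proj₂ (π-range u)))
    ; proper    = proper
    ; gap-rule  = λ v → spread-gap π {nbrs R v}
    ; leaf-rule = λ v u deg≡1 adj → spread-leaf π deg≡1 (∈-nbrs⁺ adj)
    }

module _ {A : Set} {P Q R : Pred A 0ℓ} (P? : Decidable P) (Q? : Decidable Q) (R? : Decidable R) where

  length-filter-⊎ : (∀ {x} → P x → Q x ⊎ R x) → ∀ xs →
                    length (filter P? xs) ≤ length (filter Q? xs) + length (filter R? xs)
  length-filter-⊎ P⇒Q⊎R [] = z≤n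
  length-filter-⊎ P⇒Q⊎R (x ∷ xs) with ih ← length-filter-⊎ P⇒Q⊎R xs | P? x | Q? x | R? x
  ... | no _   | no _  | no _  = ih
  ... | no _   | no _  | yes _ = ≤-trans ih (+-monoʳ-≤ _ (n≤1+n _))
  ... | no _   | yes _ | no _  = m≤n⇒m≤1+n ih
  ... | no _   | yes _ | yes _ = m≤n⇒m≤1+n (≤-trans ih (+-monoʳ-≤ _ (n≤1+n _)))
  ... | yes _  | yes _ | no _  = s≤s ih
  ... | yes _  | yes _ | yes _ = s≤s (≤-trans ih (+-monoʳ-≤ _ (n≤1+n _)))
  ... | yes _  | no _  | yes _ = ≤-trans (s≤s ih) (≤-reflexive (sym (+-suc _ _)))
  ... | yes px | no ¬q | no ¬r with P⇒Q⊎R px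
  ...   | inj₁ q = contradiction q ¬q
  ...   | inj₂ r = contradiction r ¬r

length-increasing : ∀ {a b xs} → AllPairs _<_ xs → All (λ x → a ≤ x × x < b) xs →
                    length xs ≤ b ∸ a
length-increasing [] [] = z≤n
length-increasing {a} {b} {x ∷ xs} (x<xs ∷ increasing) ((a≤x , x<b) ∷ within) = begin
  suc (length xs)  ≤⟨ s≤s (length-increasing increasing
                        (All.zipWith (λ (x<y , (_ , y<b)) → x<y , y<b) (x<xs , within))) ⟩
  suc (b ∸ suc x)  ≡⟨ sym (+-∸-assoc 1 x<b) ⟩
  b ∸ x            ≤⟨ ∸-monoʳ-≤ b a≤x ⟩
  b ∸ a            ∎
  where open ≤-Reasoning

allFin-increasing : ∀ n → AllPairs F._<_ (allFin n)
allFin-increasing zero    = []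
allFin-increasing (suc n) = All.tabulate⁺ (λ _ → z<s)
  ∷ subst (AllPairs F._<_) (map-tabulate id F.suc)
          (AllPairs.map⁺ (AllPairs.map s<s (allFin-increasing n)))

length-filter-window : ∀ {n} {P : Pred (Fin n) 0ℓ} (P? : Decidable P) {a b} →
  (∀ {v} → P v → a ≤ toℕ v × toℕ v < b) → length (filter P? (allFin n)) ≤ b ∸ a
length-filter-window {n} P? within = subst (_≤ _) (length-map toℕ (filter P? (allFin n)))
  (length-increasing (AllPairs.map⁺ (AllPairs.filter⁺ P? (allFin-increasing n)))
                     (All.map⁺ (All.map within (All.all-filter P? (allFin n)))))

module _ {A B : Set} {P : Pred (A × B) 0ℓ} (P? : Decidable P) where

  length-filter-row : ∀ x ys →
    length (filter P? (map (x ,_) ys)) ≡ length (filter (λ y → P? (x , y)) ys)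
  length-filter-row x [] = refl
  length-filter-row x (y ∷ ys) with P? (x , y)
  ... | yes _ = cong suc (length-filter-row x ys)
  ... | no _  = length-filter-row x ys

  length-filter-cartesianProduct : ∀ {b} xs ys →
    (∀ x → length (filter (λ y → P? (x , y)) ys) ≤ b) →
    length (filter P? (cartesianProduct xs ys)) ≤ length xs * b
  length-filter-cartesianProduct [] ys rows = z≤n
  length-filter-cartesianProduct {b} (x ∷ xs) ys rows = begin
    length (filter P? (map (x ,_) ys ++ cartesianProduct xs ys))
      ≡⟨ cong length (filter-++ P? (map (x ,_) ys) (cartesianProduct xs ys)) ⟩
    length (filter P? (map (x ,_) ys) ++ filter P? (cartesianProduct xs ys))
      ≡⟨ length-++ (filter P? (map (x ,_) ys)) ⟩
    length (filter P? (map (x ,_) ys)) + length (filter P? (cartesianProduct xs ys))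
      ≤⟨ +-mono-≤ (≤-trans (≤-reflexive (length-filter-row x ys)) (rows x))
                  (length-filter-cartesianProduct xs ys rows) ⟩
    b + length xs * b ∎
    where open ≤-Reasoning

¬T⇒T-not : ∀ {b} → ¬ T b → T (not b)
¬T⇒T-not {false} _ = _
¬T⇒T-not {true} ¬t = ¬t _

T-not⇒¬T : ∀ {b} → T (not b) → ¬ T b
T-not⇒¬T {false} _ ()

module Removal {n} (_≁_ : Fin n → Fin n → Set) (≁-sym : ∀ {u v} → u ≁ v → v ≁ u)
                   (_≁?_ : ∀ u v → Dec (u ≁ v)) where

  Removed : Fin n × Fin n → Set
  Removed e = proj₁ e F.< proj₂ e × proj₁ e ≁ proj₂ e

  removed? : ∀ e → Dec (Removed e)
  removed? (i , j) = (i <ᶠ? j) ×-dec (i ≁? j)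

  pairs : List (Fin n × Fin n)
  pairs = cartesianProduct (allFin n) (allFin n)

  removal : EdgeList n
  removal = filter removed? pairs

  removal-wellFormed : WellFormedRemoval removal
  removal-wellFormed = All.map proj₁ (All.all-filter removed? pairs)
                     , filter⁺ removed? (cartesianProduct⁺ (allFin⁺ n) (allFin⁺ n))

  length-removal : ∀ {b} → (∀ i → length (filter (λ j → removed? (i , j)) (allFin n)) ≤ b) →
                   length removal ≤ n * b
  length-removal {b} rows = subst (λ m → length removal ≤ m * b) (length-tabulate {n = n} id)
    (length-filter-cartesianProduct removed? (allFin n) (allFin n) rows)

  matches : Fin n → Fin n → Fin n × Fin n → Bool
  matches i j e = ⌊ proj₁ e ≟ᶠ i ⌋ ∧ ⌊ proj₂ e ≟ᶠ j ⌋

  memb-removal⁻ : ∀ {i j} → T (memb i j removal) → Removed (i , j)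
  memb-removal⁻ {i} {j} t with find (any⁻ (matches i j) removal t)
  ... | (k , l) , e∈ , match with Equivalence.to T-∧ match
  ...   | k≡i , l≡j with toWitness {a? = k ≟ᶠ i} k≡i | toWitness {a? = l ≟ᶠ j} l≡j
  ...     | refl | refl = proj₂ (∈-filter⁻ removed? {xs = pairs} e∈)

  memb-removal⁺ : ∀ {i j} → Removed (i , j) → T (memb i j removal)
  memb-removal⁺ {i} {j} r = any⁺ (matches i j)
    (lose (∈-filter⁺ removed? (∈-cartesianProduct⁺ (∈-allFin i) (∈-allFin j)) r)
          (Equivalence.from T-∧ (fromWitness {a? = i ≟ᶠ i} refl , fromWitness {a? = j ≟ᶠ j} refl)))

  memb∨memb⇒≁ : ∀ {u v} → T (memb u v removal ∨ memb v u removal) → u ≁ v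
  memb∨memb⇒≁ = [ proj₂ ∘ memb-removal⁻ , ≁-sym ∘ proj₂ ∘ memb-removal⁻ ] ∘ Equivalence.to T-∨

  ≁⇒memb∨memb : ∀ {u v} → u ≢ v → u ≁ v → T (memb u v removal ∨ memb v u removal)
  ≁⇒memb∨memb {u} {v} u≢v u≁v with <ᶠ-cmp u v
  ... | tri< u<v _ _ = Equivalence.from T-∨ (inj₁ (memb-removal⁺ (u<v , u≁v)))
  ... | tri≈ _ u≡v _ = contradiction u≡v u≢v
  ... | tri> _ _ v<u = Equivalence.from T-∨ (inj₂ (memb-removal⁺ (v<u , ≁-sym u≁v)))

  adj-removal⁻ : ∀ {u v} → Adj removal u v ≡ true → u ≢ v × ¬ u ≁ v
  adj-removal⁻ adj with Equivalence.to T-∧ (Equivalence.from T-≡ adj)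
  ... | distinct , kept = u≢v , T-not⇒¬T kept ∘ ≁⇒memb∨memb u≢v
    where u≢v = toWitnessFalse distinct

  adj-removal⁺ : ∀ {u v} → u ≢ v → ¬ u ≁ v → Adj removal u v ≡ true
  adj-removal⁺ u≢v ¬u≁v = Equivalence.to T-≡
    (Equivalence.from T-∧ (fromWitnessFalse u≢v , ¬T⇒T-not (¬u≁v ∘ memb∨memb⇒≁)))

m/n≡o/n⇒o<m+n : ∀ {n} .{{_ : NonZero n}} m o → m / n ≡ o / n → o < m + n
m/n≡o/n⇒o<m+n {n} m o m/n≡o/n = begin-strict
  o                  ≡⟨ m≡m%n+[m/n]*n o n ⟩
  o % n + o / n * n  <⟨ +-monoˡ-< (o / n * n) (m%n<n o n) ⟩
  n + o / n * n      ≡⟨ cong (λ q → n + q * n) m/n≡o/n ⟨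
  n + m / n * n      ≤⟨ +-monoʳ-≤ n (m/n*n≤m m n) ⟩
  n + m              ≡⟨ +-comm n m ⟩
  m + n              ∎
  where open ≤-Reasoning

≤1⇒≢2*suc : ∀ {a b g} → a ≤ 1 → b ≡ 2 * suc g → a ≢ b
≤1⇒≢2*suc a≤1 refl refl = <⇒≱ (s≤s a≤1) (*-monoʳ-≤ 2 (s≤s z≤n))

module Construction (n p : ℕ) where

  s : ℕ
  s = suc p

  data Kind : Set where
    top bottom : ℕ → Kind

  kind : ℕ → Kind
  kind x with n ≤? x + s
  ... | yes _ = top (x + s ∸ n)
  ... | no _  = bottom (x / s)

  data KindOf (x : ℕ) : Kind → Set where
    top    : n ≤ x + s → KindOf x (top (x + s ∸ n))
    bottom : x + s < n → KindOf x (bottom (x / s))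

  kindOf : ∀ x → KindOf x (kind x)
  kindOf x with n ≤? x + s
  ... | yes n≤x+s = top n≤x+s
  ... | no n≰x+s  = bottom (≰⇒> n≰x+s)

  Conflict : Kind → Kind → Set
  Conflict (top _)    (top _)    = ⊤
  Conflict (top t)    (bottom g) = suc g < t
  Conflict (bottom g) (top t)    = suc g < t
  Conflict (bottom g) (bottom h) = g ≡ h

  conflict? : ∀ k l → Dec (Conflict k l)
  conflict? (top _)    (top _)    = yes tt
  conflict? (top t)    (bottom g) = suc g <? t
  conflict? (bottom g) (top t)    = suc g <? t
  conflict? (bottom g) (bottom h) = g ≟ h

  conflict-sym : ∀ {k l} → Conflict k l → Conflict l k
  conflict-sym {top _}    {top _}    c = c
  conflict-sym {top _}    {bottom _} c = c
  conflict-sym {bottom _} {top _}    c = c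
  conflict-sym {bottom _} {bottom _} c = sym c

  label : Kind → ℕ
  label (top t)    = suc (2 * t)
  label (bottom _) = 1

  _≁_ : Fin n → Fin n → Set
  u ≁ v = Conflict (kind (toℕ u)) (kind (toℕ v))

  open Removal _≁_ conflict-sym (λ u v → conflict? (kind (toℕ u)) (kind (toℕ v))) public

  π : Fin n → ℕ
  π v = label (kind (toℕ v))

  kind-top : ∀ {x} → n ≤ x + s → kind x ≡ top (x + s ∸ n)
  kind-top {x} n≤x+s with kind x | kindOf x
  ... | _ | top _        = refl
  ... | _ | bottom x+s<n = contradiction n≤x+s (<⇒≱ x+s<n)

  kind-bottom : ∀ {x} → x + s < n → kind x ≡ bottom (x / s)
  kind-bottom {x} x+s<n with kind x | kindOf x
  ... | _ | top n≤x+s = contradiction n≤x+s (<⇒≱ x+s<n)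
  ... | _ | bottom _  = refl

  label≤ : ∀ {x} → x < n → label (kind x) ≤ suc (2 * s)
  label≤ {x} x<n with kind x | kindOf x
  ... | _ | top _    = s≤s (*-monoʳ-≤ 2 (m≤n+o⇒m∸n≤o (x + s) n (+-monoˡ-≤ s (<⇒≤ x<n))))
  ... | _ | bottom _ = s≤s z≤n

  1≤label : ∀ k → 1 ≤ label k
  1≤label (top _)    = s≤s z≤n
  1≤label (bottom _) = s≤s z≤n

  label-beside-top : ∀ {k t} → ¬ Conflict k (top t) → label k ≡ 1
  label-beside-top {top _}    ¬c = contradiction tt ¬c
  label-beside-top {bottom _} ¬c = refl

  label-beside-bottom : ∀ {k g} → ¬ Conflict k (bottom g) → label k ≤ suc (2 * suc g)
  label-beside-bottom {top _}    ¬c = s≤s (*-monoʳ-≤ 2 (≮⇒≥ ¬c))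
  label-beside-bottom {bottom _} ¬c = s≤s z≤n

  module TopVertices (s≤n : s ≤ n) where

    n∸s+j+s≡n+j : ∀ j → n ∸ s + j + s ≡ n + j
    n∸s+j+s≡n+j j = begin
      n ∸ s + j + s    ≡⟨ +-assoc (n ∸ s) j s ⟩
      n ∸ s + (j + s)  ≡⟨ cong (n ∸ s +_) (+-comm j s) ⟩
      n ∸ s + (s + j)  ≡⟨ +-assoc (n ∸ s) s j ⟨
      n ∸ s + s + j    ≡⟨ cong (_+ j) (m∸n+n≡m s≤n) ⟩
      n + j            ∎
      where open ≡-Reasoning

    topVertex : ∀ j → j < s → Fin n
    topVertex j j<s = fromℕ< (begin-strict
      n ∸ s + j  <⟨ +-monoʳ-< (n ∸ s) j<s ⟩
      n ∸ s + s  ≡⟨ m∸n+n≡m s≤n ⟩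
      n          ∎)
      where open ≤-Reasoning

    kind-topVertex : ∀ j (j<s : j < s) → kind (toℕ (topVertex j j<s)) ≡ top j
    kind-topVertex j j<s = begin
      kind (toℕ (topVertex j j<s))  ≡⟨ cong kind (toℕ-fromℕ< _) ⟩
      kind (n ∸ s + j)
        ≡⟨ kind-top (subst (n ≤_) (sym (n∸s+j+s≡n+j j)) (m≤m+n n j)) ⟩
      top (n ∸ s + j + s ∸ n)       ≡⟨ cong (λ x → top (x ∸ n)) (n∸s+j+s≡n+j j) ⟩
      top (n + j ∸ n)               ≡⟨ cong top (m+n∸m≡n n j) ⟩
      top j                         ∎
      where open ≡-Reasoning

  ≢-by-kind : ∀ {u v : Fin n} {k l} → kind (toℕ u) ≡ k → kind (toℕ v) ≡ l → k ≢ l → u ≢ v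
  ≢-by-kind ku kv k≢l refl = k≢l (trans (sym ku) kv)

  colour : Fin n → ℕ
  colour = gapColour removal π

  nbr-¬conflict : ∀ {w v} → w ∈ nbrs removal v → ¬ Conflict (kind (toℕ w)) (kind (toℕ v))
  nbr-¬conflict = proj₂ ∘ adj-removal⁻ ∘ ∈-nbrs⁻ removal

  colour-top : ∀ v → n ≤ toℕ v + s → colour v ≤ 1
  colour-top v n≤v+s = spread-≤ π (All.tabulate λ w∈ →
    ≤-reflexive (label-beside-top
      (subst (λ k → ¬ Conflict _ k) (kind-top n≤v+s) (nbr-¬conflict {v = v} w∈))))

  module _ (n≤s*s : n ≤ s * s) where

    group<p : ∀ {x} → x + s < n → x / s < p
    group<p {x} x+s<n = m<n*o⇒m/o<n (+-cancelˡ-< s x (p * s)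
      (subst (_< s + p * s) (+-comm x s) (≤-trans x+s<n n≤s*s)))

    colour-bottom : ∀ v → toℕ v + s < n → colour v ≡ 2 * suc (toℕ v / s)
    colour-bottom v v+s<n = spread-≡ π (inNbrs {j<s = z<s} z≤n) (inNbrs {j<s = g+1<s} ≤-refl)
      (≢-by-kind (kind-topVertex 0 z<s) (kind-topVertex (suc g) g+1<s) λ ())
      (cong label (kind-topVertex 0 z<s)) (cong label (kind-topVertex (suc g) g+1<s)) bounds
      where
        open TopVertices (≤-trans (m≤n+m s (toℕ v)) (<⇒≤ v+s<n))
        g = toℕ v / s
        g+1<s : suc g < s
        g+1<s = s≤s (group<p v+s<n)
        kv : kind (toℕ v) ≡ bottom g
        kv = kind-bottom v+s<n
        inNbrs : ∀ {j j<s} → j ≤ suc g → topVertex j j<s ∈ nbrs removal v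
        inNbrs {j} {j<s} j≤g+1 = ∈-nbrs⁺ removal (adj-removal⁺
          (≢-by-kind (kind-topVertex j j<s) kv λ ())
          (λ c → ≤⇒≯ j≤g+1 (subst₂ Conflict (kind-topVertex j j<s) kv c)))
        bounds : All (λ w → 1 ≤ π w × π w ≤ suc (2 * suc g)) (nbrs removal v)
        bounds = All.tabulate λ {w} w∈ →
          1≤label _ ,
          label-beside-bottom (subst (λ k → ¬ Conflict _ k) kv (nbr-¬conflict {v = v} w∈))

    colour-proper : ∀ u v → Adj removal u v ≡ true → colour u ≢ colour v
    colour-proper u v adj
      with kind (toℕ u) | kindOf (toℕ u) | kind (toℕ v) | kindOf (toℕ v) | proj₂ (adj-removal⁻ adj)
    ... | _ | top _        | _ | top _        | ¬c = contradiction tt ¬c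
    ... | _ | top n≤u+s    | _ | bottom v+s<n | _ =
      ≤1⇒≢2*suc (colour-top u n≤u+s) (colour-bottom v v+s<n)
    ... | _ | bottom u+s<n | _ | top n≤v+s    | _ =
      ≤1⇒≢2*suc (colour-top v n≤v+s) (colour-bottom u u+s<n) ∘ sym
    ... | _ | bottom u+s<n | _ | bottom v+s<n | ¬c = λ eq → ¬c (suc-injective (*-cancelˡ-≡ _ _ 2
      (trans (sym (colour-bottom u u+s<n)) (trans eq (colour-bottom v v+s<n)))))

    isGapLabelling : IsGapLabelling removal (suc (2 * s)) π colour
    isGapLabelling =
      gapColour-isGapLabelling removal π (λ v → 1≤label _ , label≤ (toℕ<n v)) colour-proper

  InBlockAfter : Fin n → Fin n → Set
  InBlockAfter i j = suc (toℕ i) ≤ toℕ j × toℕ j < toℕ i + s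

  inBlockAfter? : ∀ i j → Dec (InBlockAfter i j)
  inBlockAfter? i j = (suc (toℕ i) ≤? toℕ j) ×-dec (toℕ j <? toℕ i + s)

  InTop : Fin n → Set
  InTop j = n ∸ s ≤ toℕ j × toℕ j < n

  inTop? : ∀ j → Dec (InTop j)
  inTop? j = (n ∸ s ≤? toℕ j) ×-dec (toℕ j <? n)

  removed⇒window : ∀ i j → Removed (i , j) → InBlockAfter i j ⊎ InTop j
  removed⇒window i j (i<j , c)
    with kind (toℕ i) | kindOf (toℕ i) | kind (toℕ j) | kindOf (toℕ j) | c
  ... | _ | _            | _ | top n≤j+s    | _ =
    inj₂ (m≤n+o⇒m∸n≤o n s (subst (n ≤_) (+-comm (toℕ j) s) n≤j+s) , toℕ<n j)
  ... | _ | top n≤i+s    | _ | bottom j+s<n | _ =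
    contradiction (≤-trans n≤i+s (+-monoˡ-≤ s (<⇒≤ i<j))) (<⇒≱ j+s<n)
  ... | _ | bottom _     | _ | bottom _     | same = inj₁ (i<j , m/n≡o/n⇒o<m+n (toℕ i) (toℕ j) same)

  removed-row≤ : ∀ i → length (filter (λ j → removed? (i , j)) (allFin n)) ≤ 2 * s
  removed-row≤ i = begin
    length (filter (λ j → removed? (i , j)) (allFin n))
      ≤⟨ length-filter-⊎ (λ j → removed? (i , j)) (inBlockAfter? i) inTop?
                         (removed⇒window i _) (allFin n) ⟩
    length (filter (inBlockAfter? i) (allFin n)) + length (filter inTop? (allFin n))
      ≤⟨ +-mono-≤ (length-filter-window (inBlockAfter? i) id) (length-filter-window inTop? id) ⟩
    (toℕ i + s ∸ suc (toℕ i)) + (n ∸ (n ∸ s))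
      ≤⟨ +-mono-≤ (m≤n+o⇒m∸n≤o (toℕ i + s) (suc (toℕ i)) (n≤1+n _))
                  (m≤n+o⇒m∸n≤o n (n ∸ s) (subst (n ≤_) (+-comm s (n ∸ s)) (m≤n+m∸n n s))) ⟩
    s + s
      ≡⟨ cong (s +_) (+-identityʳ s) ⟨
    2 * s ∎
    where open ≤-Reasoning

sqrt-bracket : ∀ n → ∃[ p ] (p * p ≤ n × n ≤ suc p * suc p)
sqrt-bracket zero = 0 , z≤n , z≤n
sqrt-bracket (suc n) with sqrt-bracket n
... | p , p²≤n , n≤[p+1]² with suc n ≤? suc p * suc p
...   | yes n<[p+1]² = p , m≤n⇒m≤1+n p²≤n , n<[p+1]²
...   | no  n≮[p+1]² = suc p , <⇒≤ [p+1]²<1+n ,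
  ≤-trans (s≤s n≤[p+1]²) (*-mono-< (n<1+n (suc p)) (n<1+n (suc p)))
  where [p+1]²<1+n = ≰⇒> n≮[p+1]²

m≤m*m : ∀ m → m ≤ m * m
m≤m*m zero    = z≤n
m≤m*m (suc m) = m≤m*n (suc m) (suc m)

[1+p]²≤4n : ∀ {p n} → 1 ≤ n → p * p ≤ n → suc p * suc p ≤ 4 * n
[1+p]²≤4n {p} {n} 1≤n p²≤n = begin
  suc p * suc p
    ≡⟨ solve 1 (λ p → (con 1 :+ p) :* (con 1 :+ p) := p :* p :+ con 2 :* p :+ con 1) refl p ⟩
  p * p + 2 * p + 1  ≤⟨ +-mono-≤ (+-mono-≤ p²≤n (*-monoʳ-≤ 2 p≤n)) 1≤n ⟩
  n + 2 * n + n      ≡⟨ solve 1 (λ n → n :+ con 2 :* n :+ n := con 4 :* n) refl n ⟩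
  4 * n              ∎
  where
    open ≤-Reasoning
    open +-*-Solver
    p≤n : p ≤ n
    p≤n = ≤-trans (m≤m*m p) p²≤n

square-bound : ∀ {n s l} → l ≤ n * (2 * s) → s * s ≤ 4 * n → l * l ≤ 4 * 4 * n ^ 3
square-bound {n} {s} {l} l≤2ns s²≤4n = begin
  l * l                        ≤⟨ *-mono-≤ l≤2ns l≤2ns ⟩
  n * (2 * s) * (n * (2 * s))
    ≡⟨ solve 2 (λ n s → n :* (con 2 :* s) :* (n :* (con 2 :* s)) := con 4 :* (s :* s) :* (n :* n)) refl n s ⟩
  4 * (s * s) * (n * n)        ≤⟨ *-monoˡ-≤ (n * n) (*-monoʳ-≤ 4 s²≤4n) ⟩
  4 * (4 * n) * (n * n)
    ≡⟨ solve 1 (λ n → con 4 :* (con 4 :* n) :* (n :* n) := con 4 :* con 4 :* (n :^ 3)) refl n ⟩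
  4 * 4 * n ^ 3                ∎
  where
    open ≤-Reasoning
    open +-*-Solver

theorem9 : ∃[ C ] (0 < C × (∀ (n : ℕ) → n ≥ 4 →
               ∃[ l ] (l * l ≤ C * C * n ^ 3 × SomeInKnMinusLabelable n l)))
theorem9 = 4 , z<s , λ n n≥4 →
  let p , p²≤n , n≤[p+1]² = sqrt-bracket n
      open Construction n p
  in length removal
   , square-bound {n} {s} (length-removal removed-row≤)
                          ([1+p]²≤4n {p} (≤-trans (s≤s z≤n) n≥4) p²≤n)
   , removal , removal-wellFormed , refl , suc (2 * s) , π , colour , isGapLabelling n≤[p+1]²
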